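{- In any cartesian bicategory satisfying the axiom of choice, every surjective map $\pi\colon X\to Y$ splits: there is a map $g\colon Y\to X$ with $g;\pi=\mathrm{id}_Y$.
   Context: Composition is diagrammatic ($R;S$ means first $R$ then $S$). A cartesian bicategory is a (strict) symmetric monoidal category $(\mathcal{B},\otimes,I)$ with symmetry $\sigma$, enriched over posets (hom-sets ordered by $\le$, with $;$ and $\otimes$ monotone), where every object $X$ has $\delta_X\colon X\to X\otimes X$, $\varepsilon_X\colon X\to I$ such that: (1) they form a cocommutative comonoid; (2) they have right adjoints $\delta_X^*,\varepsilon_X^*$: $\mathrm{id}_X\le\delta_X;\delta_X^*$, $\delta_X^*;\delta_X\le\mathrm{id}$, $\mathrm{id}_X\le\varepsilon_X;\varepsilon_X^*$, $\varepsilon_X^*;\varepsilon_X\le\mathrm{id}_I$; (3) $\delta_X^*;\delta_X=(\mathrm{id}_X\otimes\delta_X);(\delta_X^*\otimes\mathrm{id}_X)$; (4) every $R\colon X\to Y$ satisfies $R;\delta_Y\le\delta_X;(R\otimes R)$ and $R;\varepsilon_Y\le\varepsilon_X$; (5) $\varepsilon_{X\otimes Y}=\varepsilon_X\otimes\varepsilon_Y$, $\delta_{X\otimes Y}=(\delta_X\otimes\delta_Y);(\mathrm{id}\otimes\sigma_{X,Y}\otimes\mathrm{id})$, $\varepsilon_I=\delta_I=\mathrm{id}_I$. $R\colon X\to Y$ is single valued if $\delta_X;(R\otimes R)\le R;\delta_Y$, total if $\varepsilon_X\le R;\varepsilon_Y$, surjective if $\varepsilon_Y^*\le\varepsilon_X^*;R$.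 A map is a single valued total morphism. The cartesian bicategory satisfies the axiom of choice if for every total $R\colon X\to Y$ there is a map $f\colon X\to Y$ with $f\le R$. -}

module Defs where

open import Level using (Level; _⊔_; suc)
open import Relation.Binary.PropositionalEquality using (_≡_; refl; sym; trans; cong; subst)
open import Data.Product using (Σ; _×_)

cast : ∀ {o m} {Obj : Set o} (Hom : Obj → Obj → Set m) {A A' B B' : Obj} →
       A ≡ A' → B ≡ B' → Hom A B → Hom A' B'
cast Hom p q f = subst (λ Z → Hom Z _) p (subst (Hom _) q f)

-- Equality of morphisms is propositional
-- equality; strictness of ⊗ is given by propositional equations between
-- objects and morphism equations transported along them with 'cast'.
-- Composition is diagrammatic: f ⨾ g = first f, then g.

record CartesianBicategory (o m ℓ : Level) : Set (suc (o ⊔ m ⊔ ℓ)) where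
  infixr 9 _⨾_
  infixr 10 _⊗₀_ _⊗₁_
  infix 4 _≤_
  field
    Obj  : Set o
    Hom  : Obj → Obj → Set m
    id   : ∀ {X} → Hom X X
    _⨾_  : ∀ {X Y Z} → Hom X Y → Hom Y Z → Hom X Z
    _≤_  : ∀ {X Y} → Hom X Y → Hom X Y → Set ℓ

    idˡ    : ∀ {X Y} (f : Hom X Y) → id ⨾ f ≡ f
    idʳ    : ∀ {X Y} (f : Hom X Y) → f ⨾ id ≡ f
    assoc  : ∀ {W X Y Z} (f : Hom W X) (g : Hom X Y) (h : Hom Y Z) →
             (f ⨾ g) ⨾ h ≡ f ⨾ (g ⨾ h)

    ≤-refl    : ∀ {X Y} {f : Hom X Y} → f ≤ f
    ≤-trans   : ∀ {X Y} {f g h : Hom X Y} → f ≤ g → g ≤ h → f ≤ h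
    ≤-antisym : ∀ {X Y} {f g : Hom X Y} → f ≤ g → g ≤ f → f ≡ g
    ⨾-mono    : ∀ {X Y Z} {f f' : Hom X Y} {g g' : Hom Y Z} →
                f ≤ f' → g ≤ g' → f ⨾ g ≤ f' ⨾ g'

    _⊗₀_ : Obj → Obj → Obj
    I    : Obj
    _⊗₁_ : ∀ {X Y X' Y'} → Hom X Y → Hom X' Y' → Hom (X ⊗₀ X') (Y ⊗₀ Y')
    ⊗-mono : ∀ {X Y X' Y'} {f g : Hom X Y} {f' g' : Hom X' Y'} →
             f ≤ g → f' ≤ g' → f ⊗₁ f' ≤ g ⊗₁ g'
    ⊗-id   : ∀ {X Y} → id {X} ⊗₁ id {Y} ≡ id
    ⊗-⨾    : ∀ {X Y Z X' Y' Z'} (f : Hom X Y) (g : Hom Y Z)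
               (f' : Hom X' Y') (g' : Hom Y' Z') →
             (f ⨾ g) ⊗₁ (f' ⨾ g') ≡ (f ⊗₁ f') ⨾ (g ⊗₁ g')
    ⊗-assoc₀ : ∀ X Y Z → (X ⊗₀ Y) ⊗₀ Z ≡ X ⊗₀ (Y ⊗₀ Z)
    unitˡ₀   : ∀ X → I ⊗₀ X ≡ X
    unitʳ₀   : ∀ X → X ⊗₀ I ≡ X
    ⊗-assoc₁ : ∀ {X Y Z X' Y' Z'} (f : Hom X X') (g : Hom Y Y') (h : Hom Z Z') →
               cast Hom (⊗-assoc₀ X Y Z) (⊗-assoc₀ X' Y' Z') ((f ⊗₁ g) ⊗₁ h)
               ≡ f ⊗₁ (g ⊗₁ h)
    unitˡ₁   : ∀ {X Y} (f : Hom X Y) →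
               cast Hom (unitˡ₀ X) (unitˡ₀ Y) (id {I} ⊗₁ f) ≡ f
    unitʳ₁   : ∀ {X Y} (f : Hom X Y) →
               cast Hom (unitʳ₀ X) (unitʳ₀ Y) (f ⊗₁ id {I}) ≡ f

    σ         : ∀ X Y → Hom (X ⊗₀ Y) (Y ⊗₀ X)
    σ-nat     : ∀ {X Y X' Y'} (f : Hom X X') (g : Hom Y Y') →
                (f ⊗₁ g) ⨾ σ X' Y' ≡ σ X Y ⨾ (g ⊗₁ f)
    σ-invol   : ∀ X Y → σ X Y ⨾ σ Y X ≡ id
    σ-hexagon : ∀ X Y Z →
                cast Hom (⊗-assoc₀ X Y Z) (⊗-assoc₀ Y X Z) (σ X Y ⊗₁ id {Z}) ⨾
                cast Hom refl (sym (⊗-assoc₀ Y Z X)) (id {Y} ⊗₁ σ X Z)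
                ≡ σ X (Y ⊗₀ Z)

    δ  : ∀ X → Hom X (X ⊗₀ X)
    ε  : ∀ X → Hom X I

    δ-coassoc : ∀ X →
                cast Hom refl (⊗-assoc₀ X X X) (δ X ⨾ (δ X ⊗₁ id)) ≡ δ X ⨾ (id ⊗₁ δ X)
    δ-counitˡ : ∀ X → cast Hom refl (unitˡ₀ X) (δ X ⨾ (ε X ⊗₁ id)) ≡ id
    δ-counitʳ : ∀ X → cast Hom refl (unitʳ₀ X) (δ X ⨾ (id ⊗₁ ε X)) ≡ id
    δ-comm    : ∀ X → δ X ⨾ σ X X ≡ δ X

    δ*  : ∀ X → Hom (X ⊗₀ X) X
    ε*  : ∀ X → Hom I X
    δ-unit   : ∀ X → id ≤ δ X ⨾ δ* X
    δ-counit : ∀ X → δ* X ⨾ δ X ≤ id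
    ε-unit   : ∀ X → id ≤ ε X ⨾ ε* X
    ε-counit : ∀ X → ε* X ⨾ ε X ≤ id

    frobenius : ∀ X →
                δ* X ⨾ δ X ≡
                cast Hom refl (sym (⊗-assoc₀ X X X)) (id {X} ⊗₁ δ X) ⨾ (δ* X ⊗₁ id {X})
      -- note: (id ⊗ δ) : X⊗X → X⊗(X⊗X) = (X⊗X)⊗X by strictness
    -- (4) lax naturality
    δ-lax : ∀ {X Y} (R : Hom X Y) → R ⨾ δ Y ≤ δ X ⨾ (R ⊗₁ R)
    ε-lax : ∀ {X Y} (R : Hom X Y) → R ⨾ ε Y ≤ ε X

    ε-⊗ : ∀ X Y → cast Hom refl (unitˡ₀ I) (ε X ⊗₁ ε Y) ≡ ε (X ⊗₀ Y)
    δ-⊗ : ∀ X Y →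
          (δ X ⊗₁ δ Y) ⨾
          cast Hom
            (sym (trans (⊗-assoc₀ X X (Y ⊗₀ Y)) (cong (X ⊗₀_) (sym (⊗-assoc₀ X Y Y)))))
            (sym (trans (⊗-assoc₀ X Y (X ⊗₀ Y)) (cong (X ⊗₀_) (sym (⊗-assoc₀ Y X Y)))))
            (id {X} ⊗₁ (σ X Y ⊗₁ id {Y}))
          ≡ δ (X ⊗₀ Y)
    ε-I : ε I ≡ id
    δ-I : cast Hom refl (unitˡ₀ I) (δ I) ≡ id

  SingleValued : ∀ {X Y} → Hom X Y → Set ℓ
  SingleValued {X} {Y} R = δ X ⨾ (R ⊗₁ R) ≤ R ⨾ δ Y

  Total : ∀ {X Y} → Hom X Y → Set ℓ
  Total {X} {Y} R = ε X ≤ R ⨾ ε Y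

  Surjective : ∀ {X Y} → Hom X Y → Set ℓ
  Surjective {X} {Y} R = ε* Y ≤ ε* X ⨾ R

  IsMap : ∀ {X Y} → Hom X Y → Set ℓ
  IsMap R = SingleValued R × Total R

  AxiomOfChoice : Set (o ⊔ m ⊔ ℓ)
  AxiomOfChoice = ∀ {X Y} (R : Hom X Y) → Total R →
                  Σ (Hom X Y) (λ f → IsMap f × f ≤ R)

module Submission where

-- Every R : X → Y has a converse R° : Y → X, obtained by pairing each y with an
-- arbitrary x (the top relation) and keeping x exactly when x R y.  By the Frobenius
-- law, R° ⨾ R ≤ id ∩ top ≤ id when R is single valued; R° is total when R is
-- surjective; and id ≤ h ⨾ h° when h is a map.  Choice applied to π° gives a map
-- g ≤ π°, so g ⨾ π is a map below the identity.  Such a map h is the identity,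
-- because id ≤ h ⨾ h° ≤ h ⨾ id° ≤ h.

open import Defs
open import Relation.Binary.PropositionalEquality
  using (_≡_; refl; sym; trans; cong; cong₂; isEquivalence; module ≡-Reasoning)
open import Relation.Binary.Bundles using (Poset)
import Relation.Binary.Reasoning.PartialOrder as PosetReasoning
open import Data.Product using (Σ; _×_; _,_)

module Properties {o m ℓ} (B : CartesianBicategory o m ℓ) where
  open CartesianBicategory B

  ≡⇒≤ : ∀ {X Y} {f g : Hom X Y} → f ≡ g → f ≤ g
  ≡⇒≤ refl = ≤-refl

  homPoset : Obj → Obj → Poset m m ℓ
  homPoset X Y = record
    { Carrier        = Hom X Y
    ; _≈_            = _≡_
    ; _≤_            = _≤_
    ; isPartialOrder = record
      { isPreorder = record
        { isEquivalence = isEquivalence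
        ; reflexive     = ≡⇒≤
        ; trans         = ≤-trans
        }
      ; antisym = ≤-antisym
      }
    }

  module ≤-Reasoning {X Y : Obj} = PosetReasoning (homPoset X Y)

  ⨾-monoˡ : ∀ {X Y Z} {f f′ : Hom X Y} (g : Hom Y Z) → f ≤ f′ → f ⨾ g ≤ f′ ⨾ g
  ⨾-monoˡ g f≤f′ = ⨾-mono f≤f′ ≤-refl

  ⨾-monoʳ : ∀ {X Y Z} (f : Hom X Y) {g g′ : Hom Y Z} → g ≤ g′ → f ⨾ g ≤ f ⨾ g′
  ⨾-monoʳ f g≤g′ = ⨾-mono ≤-refl g≤g′

  ⨾-assoc₄ : ∀ {A M N P Q R} (a : Hom A M) (b : Hom M N) (c : Hom N P) (d : Hom P Q)
             (e : Hom Q R) → (a ⨾ b ⨾ c ⨾ d) ⨾ e ≡ a ⨾ b ⨾ c ⨾ d ⨾ e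
  ⨾-assoc₄ a b c d e =
    trans (assoc a (b ⨾ c ⨾ d) e) (cong (a ⨾_) (trans (assoc b (c ⨾ d) e) (cong (b ⨾_) (assoc c d e))))

  cast-⨾ : ∀ {A A′ M M′ C C′} (p : A ≡ A′) (q : M ≡ M′) (r : C ≡ C′)
           (f : Hom A M) (g : Hom M C) →
           cast Hom p r (f ⨾ g) ≡ cast Hom p q f ⨾ cast Hom q r g
  cast-⨾ refl refl refl f g = refl

  ⨾-cast : ∀ {A M C C′} (r : C ≡ C′) (f : Hom A M) (g : Hom M C) →
           f ⨾ cast Hom refl r g ≡ cast Hom refl r (f ⨾ g)
  ⨾-cast refl f g = refl

  cast-id-⨾ : ∀ {A M C} (q : A ≡ M) (g : Hom M C) → cast Hom refl q id ⨾ g ≡ cast Hom (sym q) refl g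
  cast-id-⨾ refl g = idˡ g

  cast-mono : ∀ {A A′ M M′} (p : A ≡ A′) (q : M ≡ M′) {f g : Hom A M} →
              f ≤ g → cast Hom p q f ≤ cast Hom p q g
  cast-mono refl refl f≤g = f≤g

  cast-transpose : ∀ {A A′ M M′} (p : A ≡ A′) (q : M ≡ M′) {f : Hom A M} {g : Hom A′ M′} →
                   cast Hom p q f ≡ g → f ≡ cast Hom (sym p) (sym q) g
  cast-transpose refl refl eq = eq

  -- Relies on uniqueness of identity proofs between objects (K).
  cast-cast : ∀ {A A′ A″ M M′ M″} (p : A′ ≡ A″) (q : M′ ≡ M″) (p′ : A ≡ A′) (q′ : M ≡ M′)
              (p″ : A ≡ A″) (q″ : M ≡ M″) (f : Hom A M) →
              cast Hom p q (cast Hom p′ q′ f) ≡ cast Hom p″ q″ f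
  cast-cast refl refl refl refl refl refl f = refl

  ⊗-castʳ : ∀ {A M C C′ D D′} (f : Hom A M) (p : C ≡ C′) (q : D ≡ D′) (g : Hom C D) →
            f ⊗₁ cast Hom p q g ≡ cast Hom (cong (A ⊗₀_) p) (cong (M ⊗₀_) q) (f ⊗₁ g)
  ⊗-castʳ f refl refl g = refl

  ⊗-factor : ∀ {A M C D} (f : Hom A M) (g : Hom C D) → f ⊗₁ g ≡ (f ⊗₁ id) ⨾ (id ⊗₁ g)
  ⊗-factor f g = trans (cong₂ _⊗₁_ (sym (idʳ f)) (sym (idˡ g))) (⊗-⨾ f id id g)

  ⊗-interchange : ∀ {A M C D} (f : Hom A M) (g : Hom C D) →
                  (f ⊗₁ id) ⨾ (id ⊗₁ g) ≡ (id ⊗₁ g) ⨾ (f ⊗₁ id)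
  ⊗-interchange f g =
    trans (sym (⊗-factor f g)) (trans (cong₂ _⊗₁_ (sym (idˡ f)) (sym (idʳ g))) (⊗-⨾ id f g id))

  id⊗-⨾ : ∀ {A M C D} (f : Hom M C) (g : Hom C D) →
          (id {A} ⊗₁ f) ⨾ (id ⊗₁ g) ≡ id ⊗₁ (f ⨾ g)
  id⊗-⨾ f g = trans (sym (⊗-⨾ id id f g)) (cong (_⊗₁ (f ⨾ g)) (idˡ id))

  ⊗id-⨾ : ∀ {A M C D} (f : Hom A M) (g : Hom M C) →
          (f ⊗₁ id {D}) ⨾ (g ⊗₁ id) ≡ (f ⨾ g) ⊗₁ id
  ⊗id-⨾ f g = trans (sym (⊗-⨾ f g id id)) (cong ((f ⨾ g) ⊗₁_) (idˡ id))

  top : ∀ {X Y} → Hom X Y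
  top {X} {Y} = ε X ⨾ ε* Y

  infix 8 _∩_
  _∩_ : ∀ {X Y} → Hom X Y → Hom X Y → Hom X Y
  _∩_ {X} {Y} R S = δ X ⨾ (R ⊗₁ S) ⨾ δ* Y

  ∩-monoʳ : ∀ {X Y} (R : Hom X Y) {S S′ : Hom X Y} → S ≤ S′ → R ∩ S ≤ R ∩ S′
  ∩-monoʳ {X} R S≤S′ = ⨾-monoʳ (δ X) (⨾-monoˡ _ (⊗-mono ≤-refl S≤S′))

  ε*-lax : ∀ {X Y} (R : Hom X Y) → ε* X ⨾ R ≤ ε* Y
  ε*-lax {X} {Y} R = begin
    ε* X ⨾ R                  ≡⟨ idʳ _ ⟨
    (ε* X ⨾ R) ⨾ id           ≤⟨ ⨾-monoʳ _ (ε-unit Y) ⟩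
    (ε* X ⨾ R) ⨾ ε Y ⨾ ε* Y   ≡⟨ trans (assoc _ _ _) (cong (ε* X ⨾_) (sym (assoc _ _ _))) ⟩
    ε* X ⨾ (R ⨾ ε Y) ⨾ ε* Y   ≤⟨ ⨾-monoʳ _ (⨾-monoˡ _ (ε-lax R)) ⟩
    ε* X ⨾ ε X ⨾ ε* Y         ≡⟨ assoc _ _ _ ⟨
    (ε* X ⨾ ε X) ⨾ ε* Y       ≤⟨ ⨾-monoˡ _ (ε-counit X) ⟩
    id ⨾ ε* Y                 ≡⟨ idˡ _ ⟩
    ε* Y                      ∎
    where open ≤-Reasoning

  top-⨾ : ∀ {X Y Z} (R : Hom Y Z) → top {X} ⨾ R ≤ top
  top-⨾ {X} R = ≤-trans (≡⇒≤ (assoc _ _ _)) (⨾-monoʳ (ε X) (ε*-lax R))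

  surjective⇒id≤top⨾ : ∀ {X Y} {R : Hom X Y} → Surjective R → id ≤ top ⨾ R
  surjective⇒id≤top⨾ {Y = Y} R-surj =
    ≤-trans (ε-unit Y) (≤-trans (⨾-monoʳ (ε Y) R-surj) (≡⇒≤ (sym (assoc _ _ _))))

  total⇒id≤⨾top : ∀ {X Y} {R : Hom X Y} → Total R → id ≤ R ⨾ top
  total⇒id≤⨾top {X} R-total =
    ≤-trans (ε-unit X) (≤-trans (⨾-monoˡ _ R-total) (≡⇒≤ (assoc _ _ _)))

  ≤id-swap : ∀ {A M} (p : M ≡ A) (u : Hom A M) (v : Hom M A) →
             cast Hom refl p u ≡ id → v ⨾ u ≤ id → u ⨾ v ≤ id
  ≤id-swap refl u v refl vu≤id = ≤-trans (≡⇒≤ (trans (idˡ v) (sym (idʳ v)))) vu≤id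

  id∩top≤id : ∀ {X} → id {X} ∩ top ≤ id
  id∩top≤id {X} = begin
    δ X ⨾ (id ⊗₁ (ε X ⨾ ε* X)) ⨾ δ* X
      ≡⟨ cong (λ k → δ X ⨾ k ⨾ δ* X) (id⊗-⨾ _ _) ⟨
    δ X ⨾ ((id ⊗₁ ε X) ⨾ (id ⊗₁ ε* X)) ⨾ δ* X
      ≡⟨ trans (cong (δ X ⨾_) (assoc _ _ _)) (sym (assoc _ _ _)) ⟩
    (δ X ⨾ (id ⊗₁ ε X)) ⨾ (id ⊗₁ ε* X) ⨾ δ* X
      ≤⟨ ≤id-swap (unitʳ₀ X) _ _ (δ-counitʳ X) unit-after-counit ⟩
    id ∎
    where
    open ≤-Reasoning
    unit-after-counit : ((id ⊗₁ ε* X) ⨾ δ* X) ⨾ δ X ⨾ (id ⊗₁ ε X) ≤ id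
    unit-after-counit = begin
      ((id ⊗₁ ε* X) ⨾ δ* X) ⨾ δ X ⨾ (id ⊗₁ ε X)
        ≡⟨ trans (assoc _ _ _) (cong ((id ⊗₁ ε* X) ⨾_) (sym (assoc _ _ _))) ⟩
      (id ⊗₁ ε* X) ⨾ (δ* X ⨾ δ X) ⨾ (id ⊗₁ ε X)
        ≤⟨ ⨾-monoʳ _ (⨾-monoˡ _ (δ-counit X)) ⟩
      (id ⊗₁ ε* X) ⨾ id ⨾ (id ⊗₁ ε X)
        ≡⟨ trans (cong ((id ⊗₁ ε* X) ⨾_) (idˡ _)) (id⊗-⨾ _ _) ⟩
      id ⊗₁ (ε* X ⨾ ε X)
        ≤⟨ ⊗-mono ≤-refl (ε-counit X) ⟩
      id ⊗₁ id
        ≡⟨ ⊗-id ⟩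
      id ∎

  single-valued⇒δ-natural : ∀ {X Y} {R : Hom X Y} → SingleValued R → δ X ⨾ (R ⊗₁ R) ≡ R ⨾ δ Y
  single-valued⇒δ-natural {R = R} R-sv = ≤-antisym R-sv (δ-lax R)

  id-single-valued : ∀ {X} → SingleValued (id {X})
  id-single-valued {X} = ≡⇒≤ (trans (cong (δ X ⨾_) ⊗-id) (trans (idʳ _) (sym (idˡ _))))

  ⨾-isMap : ∀ {X Y Z} {f : Hom X Y} {g : Hom Y Z} → IsMap f → IsMap g → IsMap (f ⨾ g)
  ⨾-isMap {X} {Y} {Z} {f} {g} (f-sv , f-total) (g-sv , g-total) = sv , total
    where
    open ≤-Reasoning
    sv : δ X ⨾ ((f ⨾ g) ⊗₁ (f ⨾ g)) ≤ (f ⨾ g) ⨾ δ Z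
    sv = begin
      δ X ⨾ ((f ⨾ g) ⊗₁ (f ⨾ g))  ≡⟨ trans (cong (δ X ⨾_) (⊗-⨾ f g f g)) (sym (assoc _ _ _)) ⟩
      (δ X ⨾ (f ⊗₁ f)) ⨾ (g ⊗₁ g) ≤⟨ ⨾-monoˡ _ f-sv ⟩
      (f ⨾ δ Y) ⨾ (g ⊗₁ g)        ≡⟨ assoc _ _ _ ⟩
      f ⨾ δ Y ⨾ (g ⊗₁ g)          ≤⟨ ⨾-monoʳ f g-sv ⟩
      f ⨾ g ⨾ δ Z                 ≡⟨ assoc _ _ _ ⟨
      (f ⨾ g) ⨾ δ Z               ∎
    total : ε X ≤ (f ⨾ g) ⨾ ε Z
    total = begin
      ε X             ≤⟨ f-total ⟩
      f ⨾ ε Y         ≤⟨ ⨾-monoʳ f g-total ⟩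
      f ⨾ g ⨾ ε Z     ≡⟨ assoc _ _ _ ⟨
      (f ⨾ g) ⨾ ε Z   ∎

  copyʳ : ∀ A M → Hom (A ⊗₀ M) ((A ⊗₀ M) ⊗₀ M)
  copyʳ A M = cast Hom refl (sym (⊗-assoc₀ A M M)) (id {A} ⊗₁ δ M)

  dropˡ : ∀ {A M} → Hom A I → Hom (A ⊗₀ M) M
  dropˡ {M = M} e = cast Hom refl (unitˡ₀ M) (e ⊗₁ id {M})

  dropˡ-natural : ∀ {A A′ M M′} (f : Hom A A′) (e : Hom A′ I) (g : Hom M M′) →
                  dropˡ (f ⨾ e) ⨾ g ≡ (f ⊗₁ g) ⨾ dropˡ e
  dropˡ-natural {M = M} {M′} f e g = begin
    dropˡ (f ⨾ e) ⨾ g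
      ≡⟨ cong (dropˡ (f ⨾ e) ⨾_) (unitˡ₁ g) ⟨
    dropˡ (f ⨾ e) ⨾ cast Hom (unitˡ₀ M) (unitˡ₀ M′) (id ⊗₁ g)
      ≡⟨ cast-⨾ refl (unitˡ₀ M) (unitˡ₀ M′) _ _ ⟨
    cast Hom refl (unitˡ₀ M′) (((f ⨾ e) ⊗₁ id) ⨾ (id ⊗₁ g))
      ≡⟨ cong (cast Hom refl (unitˡ₀ M′)) (⊗-factor (f ⨾ e) g) ⟨
    cast Hom refl (unitˡ₀ M′) ((f ⨾ e) ⊗₁ g)
      ≡⟨ cong (cast Hom refl (unitˡ₀ M′))
              (trans (cong ((f ⨾ e) ⊗₁_) (sym (idʳ g))) (⊗-⨾ f e g id)) ⟩
    cast Hom refl (unitˡ₀ M′) ((f ⊗₁ g) ⨾ (e ⊗₁ id))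
      ≡⟨ ⨾-cast (unitˡ₀ M′) _ _ ⟨
    (f ⊗₁ g) ⨾ dropˡ e ∎
    where open ≡-Reasoning

  copyʳ-natural : ∀ {A A′ M} (f : Hom A A′) →
                  (f ⊗₁ id {M}) ⨾ copyʳ A′ M ≡ copyʳ A M ⨾ ((f ⊗₁ id) ⊗₁ id)
  copyʳ-natural {A} {A′} {M} f = begin
    (f ⊗₁ id) ⨾ copyʳ A′ M
      ≡⟨ ⨾-cast (sym α′) _ _ ⟩
    cast Hom refl (sym α′) ((f ⊗₁ id) ⨾ (id ⊗₁ δ M))
      ≡⟨ cong (cast Hom refl (sym α′)) (⊗-interchange f (δ M)) ⟩
    cast Hom refl (sym α′) ((id ⊗₁ δ M) ⨾ (f ⊗₁ id))
      ≡⟨ cong (λ k → cast Hom refl (sym α′) ((id ⊗₁ δ M) ⨾ (f ⊗₁ k))) ⊗-id ⟨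
    cast Hom refl (sym α′) ((id ⊗₁ δ M) ⨾ (f ⊗₁ (id ⊗₁ id)))
      ≡⟨ cong (λ k → cast Hom refl (sym α′) ((id ⊗₁ δ M) ⨾ k)) (⊗-assoc₁ f id id) ⟨
    cast Hom refl (sym α′) ((id ⊗₁ δ M) ⨾ cast Hom α α′ ((f ⊗₁ id) ⊗₁ id))
      ≡⟨ cast-⨾ refl (sym α) (sym α′) _ _ ⟩
    copyʳ A M ⨾ cast Hom (sym α) (sym α′) (cast Hom α α′ ((f ⊗₁ id) ⊗₁ id))
      ≡⟨ cong (copyʳ A M ⨾_) (cast-cast (sym α) (sym α′) α α′ refl refl _) ⟩
    copyʳ A M ⨾ ((f ⊗₁ id) ⊗₁ id) ∎
    where
    open ≡-Reasoning
    α : (A ⊗₀ M) ⊗₀ M ≡ A ⊗₀ (M ⊗₀ M)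
    α = ⊗-assoc₀ A M M
    α′ : (A′ ⊗₀ M) ⊗₀ M ≡ A′ ⊗₀ (M ⊗₀ M)
    α′ = ⊗-assoc₀ A′ M M

  copyʳ⨾dropˡ-natural : ∀ {A A′ M} (f : Hom A A′) (e : Hom (A′ ⊗₀ M) I) →
                         copyʳ A M ⨾ dropˡ ((f ⊗₁ id) ⨾ e) ≡ (f ⊗₁ id) ⨾ copyʳ A′ M ⨾ dropˡ e
  copyʳ⨾dropˡ-natural {A} {A′} {M} f e = begin
    copyʳ A M ⨾ dropˡ ((f ⊗₁ id) ⨾ e)
      ≡⟨ cong (copyʳ A M ⨾_) (trans (sym (idʳ _)) (dropˡ-natural (f ⊗₁ id) e id)) ⟩
    copyʳ A M ⨾ ((f ⊗₁ id) ⊗₁ id) ⨾ dropˡ e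
      ≡⟨ assoc _ _ _ ⟨
    (copyʳ A M ⨾ ((f ⊗₁ id) ⊗₁ id)) ⨾ dropˡ e
      ≡⟨ cong (_⨾ dropˡ e) (copyʳ-natural f) ⟨
    ((f ⊗₁ id) ⨾ copyʳ A′ M) ⨾ dropˡ e
      ≡⟨ assoc _ _ _ ⟩
    (f ⊗₁ id) ⨾ copyʳ A′ M ⨾ dropˡ e ∎
    where open ≡-Reasoning

  copyʳ-ε : ∀ A M →
            copyʳ A M ⨾ (id {A ⊗₀ M} ⊗₁ ε M) ≡ cast Hom refl (sym (unitʳ₀ (A ⊗₀ M))) id
  copyʳ-ε A M = begin
    copyʳ A M ⨾ (id ⊗₁ ε M)
      ≡⟨ cong (λ k → copyʳ A M ⨾ (k ⊗₁ ε M)) ⊗-id ⟨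
    copyʳ A M ⨾ ((id ⊗₁ id) ⊗₁ ε M)
      ≡⟨ cong (copyʳ A M ⨾_) (cast-transpose α α₁ (⊗-assoc₁ id id (ε M))) ⟩
    copyʳ A M ⨾ cast Hom (sym α) (sym α₁) (id ⊗₁ (id ⊗₁ ε M))
      ≡⟨ cast-⨾ refl (sym α) (sym α₁) _ _ ⟨
    cast Hom refl (sym α₁) ((id ⊗₁ δ M) ⨾ (id ⊗₁ (id ⊗₁ ε M)))
      ≡⟨ cong (cast Hom refl (sym α₁)) (id⊗-⨾ (δ M) (id ⊗₁ ε M)) ⟩
    cast Hom refl (sym α₁) (id ⊗₁ (δ M ⨾ (id ⊗₁ ε M)))
      ≡⟨ cong (λ k → cast Hom refl (sym α₁) (id ⊗₁ k))
              (cast-transpose refl (unitʳ₀ M) (δ-counitʳ M)) ⟩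
    cast Hom refl (sym α₁) (id ⊗₁ cast Hom refl (sym (unitʳ₀ M)) id)
      ≡⟨ cong (cast Hom refl (sym α₁)) (⊗-castʳ id refl (sym (unitʳ₀ M)) id) ⟩
    cast Hom refl (sym α₁) (cast Hom refl ρ (id ⊗₁ id))
      ≡⟨ cong (λ k → cast Hom refl (sym α₁) (cast Hom refl ρ k)) ⊗-id ⟩
    cast Hom refl (sym α₁) (cast Hom refl ρ id)
      ≡⟨ cast-cast refl (sym α₁) refl ρ refl (sym (unitʳ₀ (A ⊗₀ M))) id ⟩
    cast Hom refl (sym (unitʳ₀ (A ⊗₀ M))) id ∎
    where
    open ≡-Reasoning
    α : (A ⊗₀ M) ⊗₀ M ≡ A ⊗₀ (M ⊗₀ M)
    α = ⊗-assoc₀ A M M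
    α₁ : (A ⊗₀ M) ⊗₀ I ≡ A ⊗₀ (M ⊗₀ I)
    α₁ = ⊗-assoc₀ A M I
    ρ : A ⊗₀ M ≡ A ⊗₀ (M ⊗₀ I)
    ρ = cong (A ⊗₀_) (sym (unitʳ₀ M))

  copyʳ-dropˡ-ε : ∀ {A M} (e : Hom (A ⊗₀ M) I) → copyʳ A M ⨾ dropˡ e ⨾ ε M ≡ e
  copyʳ-dropˡ-ε {A} {M} e = begin
    copyʳ A M ⨾ dropˡ e ⨾ ε M
      ≡⟨ cong (λ k → copyʳ A M ⨾ dropˡ k ⨾ ε M) (idˡ e) ⟨
    copyʳ A M ⨾ dropˡ (id ⨾ e) ⨾ ε M
      ≡⟨ cong (copyʳ A M ⨾_) (dropˡ-natural id e (ε M)) ⟩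
    copyʳ A M ⨾ (id ⊗₁ ε M) ⨾ dropˡ e
      ≡⟨ assoc _ _ _ ⟨
    (copyʳ A M ⨾ (id ⊗₁ ε M)) ⨾ dropˡ e
      ≡⟨ cong (_⨾ dropˡ e) (copyʳ-ε A M) ⟩
    cast Hom refl (sym (unitʳ₀ (A ⊗₀ M))) id ⨾ dropˡ e
      ≡⟨ cast-id-⨾ (sym (unitʳ₀ (A ⊗₀ M))) (dropˡ e) ⟩
    cast Hom (sym (sym (unitʳ₀ (A ⊗₀ M)))) refl (cast Hom refl (unitˡ₀ I) (e ⊗₁ id))
      ≡⟨ cast-cast (sym (sym (unitʳ₀ (A ⊗₀ M)))) refl refl (unitˡ₀ I)
                   (unitʳ₀ (A ⊗₀ M)) (unitʳ₀ I) (e ⊗₁ id) ⟩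
    cast Hom (unitʳ₀ (A ⊗₀ M)) (unitʳ₀ I) (e ⊗₁ id)
      ≡⟨ unitʳ₁ e ⟩
    e ∎
    where open ≡-Reasoning

  copyʳ-single-valued : ∀ {A X Y} {R : Hom X Y} → SingleValued R →
                        copyʳ A X ⨾ ((id ⊗₁ R) ⊗₁ R) ≤ (id ⊗₁ R) ⨾ copyʳ A Y
  copyʳ-single-valued {A} {X} {Y} {R} R-sv = begin
    copyʳ A X ⨾ ((id ⊗₁ R) ⊗₁ R)
      ≡⟨ cong (copyʳ A X ⨾_)
              (cast-transpose (⊗-assoc₀ A X X) (⊗-assoc₀ A Y Y) (⊗-assoc₁ id R R)) ⟩
    copyʳ A X ⨾ cast Hom (sym (⊗-assoc₀ A X X)) (sym (⊗-assoc₀ A Y Y)) (id ⊗₁ (R ⊗₁ R))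
      ≡⟨ cast-⨾ refl (sym (⊗-assoc₀ A X X)) (sym (⊗-assoc₀ A Y Y)) _ _ ⟨
    cast Hom refl (sym (⊗-assoc₀ A Y Y)) ((id ⊗₁ δ X) ⨾ (id ⊗₁ (R ⊗₁ R)))
      ≡⟨ cong (cast Hom refl (sym (⊗-assoc₀ A Y Y))) (id⊗-⨾ _ _) ⟩
    cast Hom refl (sym (⊗-assoc₀ A Y Y)) (id ⊗₁ (δ X ⨾ (R ⊗₁ R)))
      ≤⟨ cast-mono refl (sym (⊗-assoc₀ A Y Y)) (⊗-mono ≤-refl R-sv) ⟩
    cast Hom refl (sym (⊗-assoc₀ A Y Y)) (id ⊗₁ (R ⨾ δ Y))
      ≡⟨ cong (cast Hom refl (sym (⊗-assoc₀ A Y Y))) (id⊗-⨾ _ _) ⟨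
    cast Hom refl (sym (⊗-assoc₀ A Y Y)) ((id ⊗₁ R) ⨾ (id ⊗₁ δ Y))
      ≡⟨ ⨾-cast (sym (⊗-assoc₀ A Y Y)) _ _ ⟨
    (id ⊗₁ R) ⨾ copyʳ A Y ∎
    where open ≤-Reasoning

  copyʳ-dropˡ-δ* : ∀ X → copyʳ X X ⨾ dropˡ (δ* X ⨾ ε X) ≡ δ* X
  copyʳ-dropˡ-δ* X = begin
    copyʳ X X ⨾ dropˡ (δ* X ⨾ ε X)
      ≡⟨ ⨾-cast (unitˡ₀ X) _ _ ⟩
    cast Hom refl (unitˡ₀ X) (copyʳ X X ⨾ ((δ* X ⨾ ε X) ⊗₁ id))
      ≡⟨ cong (λ k → cast Hom refl (unitˡ₀ X) (copyʳ X X ⨾ k)) (⊗id-⨾ _ _) ⟨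
    cast Hom refl (unitˡ₀ X) (copyʳ X X ⨾ (δ* X ⊗₁ id) ⨾ (ε X ⊗₁ id))
      ≡⟨ cong (cast Hom refl (unitˡ₀ X))
              (trans (sym (assoc _ _ _)) (cong (_⨾ (ε X ⊗₁ id)) (sym (frobenius X)))) ⟩
    cast Hom refl (unitˡ₀ X) ((δ* X ⨾ δ X) ⨾ (ε X ⊗₁ id))
      ≡⟨ cong (cast Hom refl (unitˡ₀ X)) (assoc _ _ _) ⟩
    cast Hom refl (unitˡ₀ X) (δ* X ⨾ δ X ⨾ (ε X ⊗₁ id))
      ≡⟨ ⨾-cast (unitˡ₀ X) _ _ ⟨
    δ* X ⨾ cast Hom refl (unitˡ₀ X) (δ X ⨾ (ε X ⊗₁ id))
      ≡⟨ cong (δ* X ⨾_) (δ-counitˡ X) ⟩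
    δ* X ⨾ id
      ≡⟨ idʳ _ ⟩
    δ* X ∎
    where open ≡-Reasoning

  δ-copyʳ : ∀ X → δ X ⨾ (δ X ⊗₁ id) ≡ δ X ⨾ copyʳ X X
  δ-copyʳ X = trans (cast-transpose refl (⊗-assoc₀ X X X) (δ-coassoc X))
                    (sym (⨾-cast (sym (⊗-assoc₀ X X X)) _ _))

  id≤δ⨾copyʳ⨾dropˡ : ∀ {X} {e : Hom (X ⊗₀ X) I} →
                     ε X ≤ δ X ⨾ e → id ≤ δ X ⨾ copyʳ X X ⨾ dropˡ e
  id≤δ⨾copyʳ⨾dropˡ {X} {e} ε≤δ⨾e = begin
    id
      ≡⟨ δ-counitˡ X ⟨
    cast Hom refl (unitˡ₀ X) (δ X ⨾ (ε X ⊗₁ id))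
      ≤⟨ cast-mono refl (unitˡ₀ X) (⨾-monoʳ (δ X) (⊗-mono ε≤δ⨾e ≤-refl)) ⟩
    cast Hom refl (unitˡ₀ X) (δ X ⨾ ((δ X ⨾ e) ⊗₁ id))
      ≡⟨ cong (λ k → cast Hom refl (unitˡ₀ X) (δ X ⨾ k)) (⊗id-⨾ _ _) ⟨
    cast Hom refl (unitˡ₀ X) (δ X ⨾ (δ X ⊗₁ id) ⨾ (e ⊗₁ id))
      ≡⟨ cong (cast Hom refl (unitˡ₀ X))
              (trans (sym (assoc _ _ _)) (trans (cong (_⨾ (e ⊗₁ id)) (δ-copyʳ X)) (assoc _ _ _))) ⟩
    cast Hom refl (unitˡ₀ X) (δ X ⨾ copyʳ X X ⨾ (e ⊗₁ id))
      ≡⟨ trans (cong (δ X ⨾_) (⨾-cast (unitˡ₀ X) _ _)) (⨾-cast (unitˡ₀ X) _ _) ⟨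
    δ X ⨾ copyʳ X X ⨾ dropˡ e ∎
    where open ≤-Reasoning

  coname : ∀ {X Y} → Hom X Y → Hom (Y ⊗₀ X) I
  coname {Y = Y} R = (id ⊗₁ R) ⨾ δ* Y ⨾ ε Y

  converse : ∀ {X Y} → Hom X Y → Hom Y X
  converse {X} {Y} R = δ Y ⨾ (id ⊗₁ top) ⨾ copyʳ Y X ⨾ dropˡ (coname R)

  converse-mono : ∀ {X Y} {R R′ : Hom X Y} → R ≤ R′ → converse R ≤ converse R′
  converse-mono {X} {Y} R≤R′ =
    ⨾-monoʳ (δ Y) (⨾-monoʳ _ (⨾-monoʳ (copyʳ Y X) (cast-mono refl (unitˡ₀ X)
      (⊗-mono (⨾-monoˡ _ (⊗-mono ≤-refl R≤R′)) ≤-refl))))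

  converse-⨾-ε : ∀ {X Y} (R : Hom X Y) → converse R ⨾ ε X ≡ (id ∩ top ⨾ R) ⨾ ε Y
  converse-⨾-ε {X} {Y} R = begin
    converse R ⨾ ε X
      ≡⟨ ⨾-assoc₄ _ _ _ _ _ ⟩
    δ Y ⨾ (id ⊗₁ top) ⨾ copyʳ Y X ⨾ dropˡ (coname R) ⨾ ε X
      ≡⟨ cong (λ k → δ Y ⨾ (id ⊗₁ top) ⨾ k) (copyʳ-dropˡ-ε (coname R)) ⟩
    δ Y ⨾ (id ⊗₁ top) ⨾ (id ⊗₁ R) ⨾ δ* Y ⨾ ε Y
      ≡⟨ cong (δ Y ⨾_) (trans (sym (assoc _ _ _)) (cong (_⨾ (δ* Y ⨾ ε Y)) (id⊗-⨾ top R))) ⟩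
    δ Y ⨾ (id ⊗₁ (top ⨾ R)) ⨾ δ* Y ⨾ ε Y
      ≡⟨ trans (assoc _ _ _) (cong (δ Y ⨾_) (assoc _ _ _)) ⟨
    (id ∩ top ⨾ R) ⨾ ε Y ∎
    where open ≡-Reasoning

  converse-⨾ : ∀ {X Y} {R : Hom X Y} → SingleValued R → converse R ⨾ R ≤ id ∩ top ⨾ R
  converse-⨾ {X} {Y} {R} R-sv = begin
    converse R ⨾ R
      ≡⟨ ⨾-assoc₄ _ _ _ _ _ ⟩
    δ Y ⨾ (id ⊗₁ top) ⨾ copyʳ Y X ⨾ dropˡ ((id ⊗₁ R) ⨾ δ* Y ⨾ ε Y) ⨾ R
      ≡⟨ cong (λ k → δ Y ⨾ (id ⊗₁ top) ⨾ copyʳ Y X ⨾ k)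
              (dropˡ-natural (id ⊗₁ R) (δ* Y ⨾ ε Y) R) ⟩
    δ Y ⨾ (id ⊗₁ top) ⨾ copyʳ Y X ⨾ ((id ⊗₁ R) ⊗₁ R) ⨾ dropˡ (δ* Y ⨾ ε Y)
      ≤⟨ ⨾-monoʳ (δ Y) (⨾-monoʳ _ (≤-trans (≡⇒≤ (sym (assoc _ _ _)))
           (≤-trans (⨾-monoˡ _ (copyʳ-single-valued R-sv)) (≡⇒≤ (assoc _ _ _))))) ⟩
    δ Y ⨾ (id ⊗₁ top) ⨾ (id ⊗₁ R) ⨾ copyʳ Y Y ⨾ dropˡ (δ* Y ⨾ ε Y)
      ≡⟨ cong (λ k → δ Y ⨾ (id ⊗₁ top) ⨾ (id ⊗₁ R) ⨾ k) (copyʳ-dropˡ-δ* Y) ⟩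
    δ Y ⨾ (id ⊗₁ top) ⨾ (id ⊗₁ R) ⨾ δ* Y
      ≡⟨ cong (δ Y ⨾_) (trans (sym (assoc _ _ _)) (cong (_⨾ δ* Y) (id⊗-⨾ top R))) ⟩
    id ∩ top ⨾ R ∎
    where open ≤-Reasoning

  converse-total : ∀ {X Y} {R : Hom X Y} → Surjective R → Total (converse R)
  converse-total {X} {Y} {R} R-surj = begin
    ε Y
      ≡⟨ idˡ (ε Y) ⟨
    id ⨾ ε Y
      ≤⟨ ⨾-monoˡ (ε Y) (δ-unit Y) ⟩
    (δ Y ⨾ δ* Y) ⨾ ε Y
      ≡⟨ cong (λ k → (δ Y ⨾ k) ⨾ ε Y) (trans (sym (idˡ _)) (cong (_⨾ δ* Y) (sym ⊗-id))) ⟩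
    (id ∩ id) ⨾ ε Y
      ≤⟨ ⨾-monoˡ (ε Y) (∩-monoʳ id (surjective⇒id≤top⨾ R-surj)) ⟩
    (id ∩ top ⨾ R) ⨾ ε Y
      ≡⟨ converse-⨾-ε R ⟨
    converse R ⨾ ε X ∎
    where open ≤-Reasoning

  converse-counit : ∀ {X Y} {R : Hom X Y} → SingleValued R → converse R ⨾ R ≤ id
  converse-counit {R = R} R-sv =
    ≤-trans (converse-⨾ R-sv) (≤-trans (∩-monoʳ id (top-⨾ R)) id∩top≤id)

  ⨾-converse : ∀ {X Y} {h : Hom X Y} → SingleValued h →
               h ⨾ converse h ≡ δ X ⨾ (h ⊗₁ (h ⨾ top)) ⨾ copyʳ Y X ⨾ dropˡ (coname h)
  ⨾-converse {X} {Y} {h} h-sv = begin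
    h ⨾ δ Y ⨾ (id ⊗₁ top) ⨾ rest
      ≡⟨ assoc _ _ _ ⟨
    (h ⨾ δ Y) ⨾ (id ⊗₁ top) ⨾ rest
      ≡⟨ cong (_⨾ ((id ⊗₁ top) ⨾ rest)) (single-valued⇒δ-natural h-sv) ⟨
    (δ X ⨾ (h ⊗₁ h)) ⨾ (id ⊗₁ top) ⨾ rest
      ≡⟨ trans (assoc _ _ _) (cong (δ X ⨾_) (sym (assoc _ _ _))) ⟩
    δ X ⨾ ((h ⊗₁ h) ⨾ (id ⊗₁ top)) ⨾ rest
      ≡⟨ cong (λ k → δ X ⨾ k ⨾ rest)
              (trans (sym (⊗-⨾ h id h top)) (cong (_⊗₁ (h ⨾ top)) (idʳ h))) ⟩
    δ X ⨾ (h ⊗₁ (h ⨾ top)) ⨾ rest ∎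
    where
    open ≡-Reasoning
    rest : Hom (Y ⊗₀ X) X
    rest = copyʳ Y X ⨾ dropˡ (coname h)

  converse-unit : ∀ {X Y} {h : Hom X Y} → IsMap h → id ≤ h ⨾ converse h
  converse-unit {X} {Y} {h} (h-sv , h-total) = begin
    id
      ≤⟨ id≤δ⨾copyʳ⨾dropˡ graph-test-total ⟩
    δ X ⨾ copyʳ X X ⨾ dropˡ ((h ⊗₁ id) ⨾ coname h)
      ≡⟨ cong (δ X ⨾_) (copyʳ⨾dropˡ-natural h (coname h)) ⟩
    δ X ⨾ (h ⊗₁ id) ⨾ copyʳ Y X ⨾ dropˡ (coname h)
      ≤⟨ ⨾-monoʳ (δ X) (⨾-monoˡ _ (⊗-mono ≤-refl (total⇒id≤⨾top h-total))) ⟩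
    δ X ⨾ (h ⊗₁ (h ⨾ top)) ⨾ copyʳ Y X ⨾ dropˡ (coname h)
      ≡⟨ ⨾-converse h-sv ⟨
    h ⨾ converse h ∎
    where
    open ≤-Reasoning
    graph-test-total : ε X ≤ δ X ⨾ (h ⊗₁ id) ⨾ coname h
    graph-test-total = begin
      ε X                             ≤⟨ h-total ⟩
      h ⨾ ε Y                         ≡⟨ cong (h ⨾_) (idˡ _) ⟨
      h ⨾ id ⨾ ε Y                    ≤⟨ ⨾-monoʳ h (⨾-monoˡ _ (δ-unit Y)) ⟩
      h ⨾ (δ Y ⨾ δ* Y) ⨾ ε Y          ≡⟨ trans (cong (h ⨾_) (assoc _ _ _)) (sym (assoc _ _ _)) ⟩
      (h ⨾ δ Y) ⨾ δ* Y ⨾ ε Y          ≡⟨ cong (_⨾ (δ* Y ⨾ ε Y)) (single-valued⇒δ-natural h-sv) ⟨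
      (δ X ⨾ (h ⊗₁ h)) ⨾ δ* Y ⨾ ε Y    ≡⟨ assoc _ _ _ ⟩
      δ X ⨾ (h ⊗₁ h) ⨾ δ* Y ⨾ ε Y
        ≡⟨ cong (δ X ⨾_) (trans (cong (_⨾ (δ* Y ⨾ ε Y)) (⊗-factor h h)) (assoc _ _ _)) ⟩
      δ X ⨾ (h ⊗₁ id) ⨾ coname h      ∎

  map≤id⇒≡id : ∀ {X} {h : Hom X X} → IsMap h → h ≤ id → h ≡ id
  map≤id⇒≡id {h = h} h-map h≤id = ≤-antisym h≤id (begin
    id                  ≤⟨ converse-unit h-map ⟩
    h ⨾ converse h      ≤⟨ ⨾-monoʳ h (converse-mono h≤id) ⟩
    h ⨾ converse id     ≡⟨ cong (h ⨾_) (idʳ _) ⟨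
    h ⨾ converse id ⨾ id ≤⟨ ⨾-monoʳ h (converse-counit id-single-valued) ⟩
    h ⨾ id              ≡⟨ idʳ h ⟩
    h                   ∎)
    where open ≤-Reasoning

lemma4p5 : ∀ {o m ℓ} (B : CartesianBicategory o m ℓ) →
    let open CartesianBicategory B in
    AxiomOfChoice → ∀ {X Y} (π : Hom X Y) → IsMap π → Surjective π →
    Σ (Hom Y X) (λ g → IsMap g × (g ⨾ π ≡ id))
lemma4p5 B choice {X} {Y} π π-map@(π-sv , _) π-surj =
  section (choice (converse π) (converse-total π-surj))
  where
  open CartesianBicategory B
  open Properties B
  section : Σ (Hom Y X) (λ g → IsMap g × g ≤ converse π) →
            Σ (Hom Y X) (λ g → IsMap g × (g ⨾ π ≡ id))
  section (g , g-map , g≤π°) = g , g-map , map≤id⇒≡id (⨾-isMap g-map π-map)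
    (≤-trans (⨾-monoˡ π g≤π°) (converse-counit π-sv))
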